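{- For any Visser frame $\langle W,R,S\rangle$, $\mathrm{Log}(W,R,S)=\mathrm{Log}(W,\tau_R,\tau_S)$.
   Context: $\mathcal{L}(\Box,\rhd)$ has propositional variables, $\top,\bot$, $\neg,\land,\lor,\to$, unary $\Box,\Diamond$ and binary $\rhd$. A Visser frame is $\langle W,R,S\rangle$ with $W\ne\varnothing$, $R$ transitive and conversely well-founded (no infinite $R$-increasing sequence), $S$ transitive and reflexive. A Visser model on it is a relation $\Vdash$ between points and formulas with Boolean clauses, $x\Vdash\Box\varphi$ iff $\forall y(xRy\Rightarrow y\Vdash\varphi)$, $x\Vdash\Diamond\varphi$ iff $\exists y(xRy\wedge y\Vdash\varphi)$, and $x\Vdash\varphi\rhd\psi$ iff for all $y$ with $xRy$ and $y\Vdash\varphi$ there is $z$ with $xRz$, $ySz$, $z\Vdash\psi$. $\mathrm{Log}(W,R,S)$ is the set of formulas true at every point in every Visser model on the frame. For a relation $P$, $\tau_P$ is the topology of $P$-upward closed subsets of $W$. For a topology $\tau$, $d_\tau(Y)=\{x: \text{every } U\in\tau \text{ containing } x \text{ meets } Y\setminus\{x\}\}$, $cd_\tau(Y)=X\setminus d_\tau(X\setminus Y)$. For a bitopological space $\langle X,\tau^0,\tau^1\rangle$, $e_{\tau^0,\tau^1}(Y,Z)=\{x:\forall U\in\tau^1[x\in d_{\tau^0}(Y\cap U)\Rightarrow x\in d_{\tau^0}(Z\cap U)]\}$; a valuation $v$ maps formulas to subsets of $X$, Boolean on connectives, with $v(\Box\varphi)=cd_{\tau^0}(v(\varphi))$,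 $v(\Diamond\varphi)=d_{\tau^0}(v(\varphi))$, $v(\varphi\rhd\psi)=e_{\tau^0,\tau^1}(v(\varphi),v(\psi))$; $\mathrm{Log}(X,\tau^0,\tau^1)$ is the set of $\varphi$ with $v(\varphi)=X$ for all valuations $v$. -}

module Defs where

open import Level using (Level; 0ℓ) renaming (suc to lsuc)
open import Data.Nat using (ℕ; suc)
open import Data.Product using (Σ; _×_; ∃-syntax; _,_)
open import Data.Sum using (_⊎_)
open import Data.Unit.Polymorphic using (⊤)
open import Data.Empty.Polymorphic using (⊥)
open import Relation.Nullary using (¬_)
open import Relation.Binary.PropositionalEquality using (_≡_; _≢_)
open import Relation.Binary.Definitions using (Transitive; Reflexive)

infixr 6 _∧'_
infixr 5 _∨'_
infixr 4 _⇒'_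
infix 7 _▷'_
data Fm : Set where
  var  : ℕ → Fm
  ⊤' ⊥' : Fm
  ¬'_  : Fm → Fm
  _∧'_ _∨'_ _⇒'_ : Fm → Fm → Fm
  □' ◇' : Fm → Fm
  _▷'_ : Fm → Fm → Fm

-- Subsets of W (truth sets) live in Set₁, so that quantification over the
-- open sets (which are subsets in Set) stays inside Set₁.
Subset : Set → Set₂
Subset W = W → Set₁

ConverselyWellFounded : {W : Set} → (W → W → Set) → Set
ConverselyWellFounded {W} R = ¬ (Σ (ℕ → W) λ f → ∀ n → R (f n) (f (suc n)))

record IsVisserFrame (W : Set) (R S : W → W → Set) : Set where
  field
    nonempty : W
    R-trans  : Transitive R
    R-cwf    : ConverselyWellFounded R
    S-trans  : Transitive S
    S-refl   : Reflexive S

module _ {W : Set} (R S : W → W → Set) (V : ℕ → Subset W) where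
  infix 2 _⊩_
  _⊩_ : W → Fm → Set₁
  x ⊩ var n   = V n x
  x ⊩ ⊤'      = ⊤
  x ⊩ ⊥'      = ⊥
  x ⊩ ¬' φ    = ¬ (x ⊩ φ)
  x ⊩ φ ∧' ψ  = (x ⊩ φ) × (x ⊩ ψ)
  x ⊩ φ ∨' ψ  = (x ⊩ φ) ⊎ (x ⊩ ψ)
  x ⊩ φ ⇒' ψ  = (x ⊩ φ) → (x ⊩ ψ)
  x ⊩ □' φ    = ∀ y → R x y → y ⊩ φ
  x ⊩ ◇' φ    = ∃[ y ] (R x y × (y ⊩ φ))
  x ⊩ φ ▷' ψ  = ∀ y → R x y → (y ⊩ φ) → ∃[ z ] (R x z × S y z × (z ⊩ ψ))

LogFrame : (W : Set) (R S : W → W → Set) → Fm → Set₂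
LogFrame W R S φ = ∀ (V : ℕ → Subset W) (x : W) → _⊩_ R S V x φ

Topology : Set → Set₁
Topology X = (X → Set) → Set

τ : {W : Set} → (W → W → Set) → Topology W
τ P U = ∀ x y → P x y → U x → U y

module _ {X : Set} where
  d : Topology X → Subset X → Subset X
  d t Y x = ∀ (U : X → Set) → t U → U x → ∃[ y ] (U y × Y y × y ≢ x)

  compl : Subset X → Subset X
  compl Y x = ¬ Y x

  cd : Topology X → Subset X → Subset X
  cd t Y = compl (d t (compl Y))

  e : Topology X → Topology X → Subset X → Subset X → Subset X
  e t0 t1 Y Z x = ∀ (U : X → Set) → t1 U →
    d t0 (λ y → Y y × U y) x → d t0 (λ z → Z z × U z) x

  val : Topology X → Topology X → (ℕ → Subset X) → Fm → Subset X
  val t0 t1 v (var n) = v n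
  val t0 t1 v ⊤' x = ⊤
  val t0 t1 v ⊥' x = ⊥
  val t0 t1 v (¬' φ) = compl (val t0 t1 v φ)
  val t0 t1 v (φ ∧' ψ) x = val t0 t1 v φ x × val t0 t1 v ψ x
  val t0 t1 v (φ ∨' ψ) x = val t0 t1 v φ x ⊎ val t0 t1 v ψ x
  val t0 t1 v (φ ⇒' ψ) x = compl (val t0 t1 v φ) x ⊎ val t0 t1 v ψ x
  val t0 t1 v (□' φ) = cd t0 (val t0 t1 v φ)
  val t0 t1 v (◇' φ) = d t0 (val t0 t1 v φ)
  val t0 t1 v (φ ▷' ψ) = e t0 t1 (val t0 t1 v φ) (val t0 t1 v ψ)

LogBitop : (X : Set) → Topology X → Topology X → Fm → Set₂
LogBitop X t0 t1 φ = ∀ (v : ℕ → Subset X) (x : X) → val t0 t1 v φ x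

{-# OPTIONS --safe #-}
module Submission where

open import Defs
open import Level using (0ℓ) renaming (suc to lsuc)
open import Axiom.ExcludedMiddle using (ExcludedMiddle)
open import Data.Product using (_×_; _,_; ∃-syntax)
open import Data.Nat using (ℕ)
open import Data.Sum using (_⊎_; inj₁; inj₂)
open import Data.Empty using (⊥-elim)
open import Data.Unit.Polymorphic using (tt)
open import Relation.Nullary using (¬_; yes; no)
open import Relation.Binary.PropositionalEquality using (_≡_; refl)
open import Relation.Binary.Definitions using (Transitive; Reflexive)

-- For R transitive and irreflexive (irreflexivity follows from converse
-- well-foundedness), the τ_R-derived set of Y consists exactly of the points
-- with an R-successor in Y: the open set {x} ∪ R[x] gives one inclusion,
-- upward closure of opens the other.  So d_τR and cd_τR are the Kripke ◇ and □,
-- and testing e_{τR,τS} against the open sets S[y] shows that it is the Visser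
-- clause for ▷.  The two semantics then agree pointwise by induction on
-- formulas; excluded middle enters because the topological valuation reads
-- → and □ classically.

cwf⇒irreflexive : {W : Set} {R : W → W → Set} → ConverselyWellFounded R →
                  ∀ {x} → ¬ R x x
cwf⇒irreflexive cwf {x} r = cwf ((λ _ → x) , λ _ → r)

module DerivedSetOfUpsets {W : Set} (R : W → W → Set)
                          (R-trans : Transitive R) (R-irrefl : ∀ {x} → ¬ R x x) where

  d-τ⇒∃successor : ∀ {Y : Subset W} {x} → d (τ R) Y x → ∃[ y ] (R x y × Y y)
  d-τ⇒∃successor {x = x} dYx with dYx (λ y → y ≡ x ⊎ R x y) reflexive-upset (inj₁ refl)
    where
    reflexive-upset : τ R (λ y → y ≡ x ⊎ R x y)
    reflexive-upset a b rab (inj₁ refl) = inj₂ rab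
    reflexive-upset a b rab (inj₂ rxa)  = inj₂ (R-trans rxa rab)
  ... | y , inj₁ refl , _  , y≢x = ⊥-elim (y≢x refl)
  ... | y , inj₂ rxy  , Yy , _   = y , rxy , Yy

  ∃successor⇒d-τ : ∀ {Y : Subset W} {x} → ∃[ y ] (R x y × Y y) → d (τ R) Y x
  ∃successor⇒d-τ {x = x} (y , rxy , Yy) U U-open Ux =
    y , U-open x y rxy Ux , Yy , λ { refl → R-irrefl rxy }

  cd-τ⇒∀successor : ExcludedMiddle (lsuc 0ℓ) → ∀ {Y : Subset W} {x} →
                    cd (τ R) Y x → ∀ y → R x y → Y y
  cd-τ⇒∀successor em {Y} cdYx y rxy with em {Y y}
  ... | yes Yy = Yy
  ... | no ¬Yy = ⊥-elim (cdYx (∃successor⇒d-τ (y , rxy , ¬Yy)))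

  ∀successor⇒cd-τ : ∀ {Y : Subset W} {x} → (∀ y → R x y → Y y) → cd (τ R) Y x
  ∀successor⇒cd-τ all dcYx with d-τ⇒∃successor dcYx
  ... | y , rxy , ¬Yy = ¬Yy (all y rxy)

  module _ (S : W → W → Set) (S-refl : Reflexive S) (S-trans : Transitive S) where

    S-image-open : ∀ y → τ S (S y)
    S-image-open y a b sab sya = S-trans sya sab

    e-τ⇒visser : ∀ {Y Z : Subset W} {x} → e (τ R) (τ S) Y Z x →
                 ∀ y → R x y → Y y → ∃[ z ] (R x z × S y z × Z z)
    e-τ⇒visser eYZx y rxy Yy
      with d-τ⇒∃successor (eYZx (S y) (S-image-open y) (∃successor⇒d-τ (y , rxy , Yy , S-refl)))
    ... | z , rxz , Zz , syz = z , rxz , syz , Zz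

    visser⇒e-τ : ∀ {Y Z : Subset W} {x} →
                 (∀ y → R x y → Y y → ∃[ z ] (R x z × S y z × Z z)) →
                 e (τ R) (τ S) Y Z x
    visser⇒e-τ visser U U-open dYUx with d-τ⇒∃successor dYUx
    ... | y , rxy , Yy , Uy with visser y rxy Yy
    ... | z , rxz , syz , Zz = ∃successor⇒d-τ (z , rxz , Zz , U-open y z syz Uy)

module TruthLemma (em : ExcludedMiddle (lsuc 0ℓ)) {W : Set} {R S : W → W → Set}
                  (F : IsVisserFrame W R S) (V : ℕ → Subset W) where
  open IsVisserFrame F
  open DerivedSetOfUpsets R R-trans (cwf⇒irreflexive {R = R} R-cwf)

  ⟦_⟧ : Fm → Subset W
  ⟦_⟧ = val (τ R) (τ S) V

  ⊩⇒val : ∀ φ x → _⊩_ R S V x φ → ⟦ φ ⟧ x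
  val⇒⊩ : ∀ φ x → ⟦ φ ⟧ x → _⊩_ R S V x φ

  ⊩⇒val (var n)  x p = p
  ⊩⇒val ⊤'       x _ = tt
  ⊩⇒val (¬' φ)   x ¬p v = ¬p (val⇒⊩ φ x v)
  ⊩⇒val (φ ∧' ψ) x (p , q) = ⊩⇒val φ x p , ⊩⇒val ψ x q
  ⊩⇒val (φ ∨' ψ) x (inj₁ p) = inj₁ (⊩⇒val φ x p)
  ⊩⇒val (φ ∨' ψ) x (inj₂ q) = inj₂ (⊩⇒val ψ x q)
  ⊩⇒val (φ ⇒' ψ) x p→q with em {_⊩_ R S V x φ}
  ... | yes p = inj₂ (⊩⇒val ψ x (p→q p))
  ... | no ¬p = inj₁ (λ v → ¬p (val⇒⊩ φ x v))
  ⊩⇒val (□' φ)   x box = ∀successor⇒cd-τ (λ y rxy → ⊩⇒val φ y (box y rxy))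
  ⊩⇒val (◇' φ)   x (y , rxy , p) = ∃successor⇒d-τ (y , rxy , ⊩⇒val φ y p)
  ⊩⇒val (φ ▷' ψ) x visser = visser⇒e-τ S S-refl S-trans λ y rxy v →
    let z , rxz , syz , q = visser y rxy (val⇒⊩ φ y v) in z , rxz , syz , ⊩⇒val ψ z q

  val⇒⊩ (var n)  x v = v
  val⇒⊩ ⊤'       x _ = tt
  val⇒⊩ (¬' φ)   x ¬v p = ¬v (⊩⇒val φ x p)
  val⇒⊩ (φ ∧' ψ) x (v , w) = val⇒⊩ φ x v , val⇒⊩ ψ x w
  val⇒⊩ (φ ∨' ψ) x (inj₁ v) = inj₁ (val⇒⊩ φ x v)
  val⇒⊩ (φ ∨' ψ) x (inj₂ w) = inj₂ (val⇒⊩ ψ x w)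
  val⇒⊩ (φ ⇒' ψ) x (inj₁ ¬v) p = ⊥-elim (¬v (⊩⇒val φ x p))
  val⇒⊩ (φ ⇒' ψ) x (inj₂ w)  _ = val⇒⊩ ψ x w
  val⇒⊩ (□' φ)   x cdv y rxy = val⇒⊩ φ y (cd-τ⇒∀successor em cdv y rxy)
  val⇒⊩ (◇' φ)   x dv =
    let y , rxy , v = d-τ⇒∃successor dv in y , rxy , val⇒⊩ φ y v
  val⇒⊩ (φ ▷' ψ) x ev y rxy p =
    let z , rxz , syz , w = e-τ⇒visser S S-refl S-trans ev y rxy (⊩⇒val φ y p)
    in z , rxz , syz , val⇒⊩ ψ z w

corollary3p7 : ExcludedMiddle (lsuc 0ℓ) →
    ∀ (W : Set) (R S : W → W → Set) → IsVisserFrame W R S →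
    ∀ (φ : Fm) → (LogFrame W R S φ → LogBitop W (τ R) (τ S) φ)
                 × (LogBitop W (τ R) (τ S) φ → LogFrame W R S φ)
corollary3p7 em W R S F φ =
  (λ valid v x → TruthLemma.⊩⇒val em F v φ x (valid v x)) ,
  (λ valid V x → TruthLemma.val⇒⊩ em F V φ x (valid V x))
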